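{- Let $k\geq 2$ and $s\geq 0$ be integers and $w$ a word, with suffix tree $\mathcal{T}_w$. Let $v$ be a non-root node of $\mathcal{T}_w$ such that $mp_s^k(\tau(p(v)))=+\infty$. Then either $mp_s^k(\tau(v))=+\infty$, or \[\frac{\delta(p(v))}{k}<mp_s^k(\tau(v))\leq\frac{\delta(p(v))}{k-1}.\]
   Context: For a word $w=a_1\cdots a_n$, $w[p..q]=a_p\cdots a_q$ if $1\le p\le q\le n$ and the empty word otherwise. A word is a $k$th power if it equals $x^k$ for some non-empty word $x$. For integers $k\ge 2$, $s\ge 0$, $mp_s^k(u)$ is the smallest integer $m>s$ such that $km\le|u|$ and the prefix of $u$ of length $km$ is a $k$th power (with period of length $m$), and $+\infty$ if no such $m$ exists. Let $\$$ be a letter not occurring in $w$. The suffix tree $\mathcal{T}_w$ is a rooted tree whose edges are labeled by non-empty words such that: every internal node other than the root has at least two children; labels of edges leaving a common node begin with different letters; there are exactly $n$ leaves $leaf_1,\dots,leaf_n$ with $\tau(leaf_i)=w[i..n]\$$, where $\tau(v)$ is the concatenation of edge labels on the path from the root to $v$ (so $\tau(v)$ may end with $\$$, which is treated as an ordinary letter). $p(v)$ denotes the father of $v$ and $\delta(v)=|\tau(v)|$ its depth. -}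

module Defs where

open import Data.Nat using (ℕ; _+_; _*_; _<_; _≤_)
open import Data.Fin using (Fin; toℕ)
open import Data.List using (List; []; _∷_; _++_; length; take; drop; map; concat; replicate; head)
open import Data.Maybe using (Maybe; just; nothing)
open import Data.Product using (Σ; _×_; ∃; ∃-syntax)
open import Relation.Binary.PropositionalEquality using (_≡_; _≢_)
open import Relation.Nullary using (¬_)
open import Function.Bundles using (_⇔_)

_^^_ : {B : Set} → List B → ℕ → List B
x ^^ k = concat (replicate k x)

PrefixPower : {B : Set} → ℕ → ℕ → List B → Set
PrefixPower k m u = ∃[ x ] (length x ≡ m × take (k * m) u ≡ x ^^ k)

MpCand : {B : Set} → ℕ → ℕ → List B → ℕ → Set
MpCand k s u m = s < m × k * m ≤ length u × PrefixPower k m u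

IsMp : {B : Set} → ℕ → ℕ → List B → ℕ → Set
IsMp k s u m = MpCand k s u m × (∀ m′ → MpCand k s u m′ → m ≤ m′)

MpInfinite : {B : Set} → ℕ → ℕ → List B → Set
MpInfinite k s u = ∀ m → ¬ MpCand k s u m

-- Suffix trees.  Letters of w are from A; the extended alphabet is Maybe A,
-- where `nothing` plays the role of the end-marker $ (so $ does not occur in w).

Letter$ : Set → Set
Letter$ A = Maybe A

-- w[i+1..n]$  (0-based i : Fin n), i.e. the suffix starting at position i+1, then $
suffix$ : {A : Set} (w : List A) → Fin (length w) → List (Maybe A)
suffix$ w i = drop (toℕ i) (map just w) ++ (nothing ∷ [])

record SuffixTree {A : Set} (w : List A) : Set where
  field
    N       : ℕ
    root    : Fin N
    father  : Fin N → Maybe (Fin N)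
    label   : Fin N → List (Maybe A)
    τ       : Fin N → List (Maybe A)
    father-root : ∀ v → (father v ≡ nothing) ⇔ (v ≡ root)
    τ-root      : τ root ≡ []
    τ-edge      : ∀ v u → father v ≡ just u → τ v ≡ τ u ++ label v
    label-ne    : ∀ v u → father v ≡ just u → label v ≢ []
    branching   : ∀ u → u ≢ root → (∃[ v ] father v ≡ just u) →
                  ∃[ v₁ ] ∃[ v₂ ] (v₁ ≢ v₂ × father v₁ ≡ just u × father v₂ ≡ just u)
    first-letters : ∀ u v₁ v₂ → father v₁ ≡ just u → father v₂ ≡ just u →
                    head (label v₁) ≡ head (label v₂) → v₁ ≡ v₂
    leaf        : Fin (length w) → Fin N
    leaf-inj    : ∀ i j → leaf i ≡ leaf j → i ≡ j
    leaf-isLeaf : ∀ i v → ¬ (father v ≡ just (leaf i))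
    leaf-all    : ∀ v → (∀ u → ¬ (father u ≡ just v)) → ∃[ i ] leaf i ≡ v
    τ-leaf      : ∀ i → τ (leaf i) ≡ suffix$ w i

  δ : Fin N → ℕ
  δ v = length (τ v)

module Submission where

-- Let x^k be the prefix of τ(v) of length km, where m = mp_s^k(τ(v)).  As mp_s^k(τ(p(v))) = ∞, this
-- prefix does not fit inside τ(p(v)), so δ(p(v)) < km.  For the upper bound, τ(v) is a prefix of some
-- suffix w[i..n]$.  If (k-1)m > δ(p(v)), the suffix w[i+m..n]$ starts with x^(k-1), so it agrees with
-- τ(v) beyond the depth of p(v); in a suffix tree its path must then run through v, making τ(v) a prefix
-- of it as well.  Iterating yields infinitely many suffixes starting with τ(v), which is absurd.  The
-- least candidate m exists because candidates are bounded by |τ(v)| and decidable.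

open import Defs
open import Data.Nat using (ℕ; zero; suc; _+_; _*_; _∸_; _<_; _≤_; _⊔_; z≤n; s≤s; _≤?_; _<?_)
open import Data.Nat.Properties
  using (≤-refl; ≤-trans; <⇒≤; <⇒≱; ≰⇒>; ≮⇒≥; n≮0; n<1+n; <-cmp; m≤m+n; m<m+n; +-suc;
         +-monoʳ-≤; m≤m⊔n; m≤n⊔m; m≤n⇒m⊓n≡m; m<1+n⇒m<n∨m≡n)
open import Data.Nat.Induction using (<-rec; <-wellFounded)
open import Data.Fin using (Fin; zero; suc; toℕ; fromℕ<)
import Data.Fin.Properties as Fin
open import Data.List using (List; []; _∷_; _++_; length; take; drop; map; head; [_])
open import Data.List.Properties
  using (++-assoc; ++-identityʳ; length-++; length-map; take-all; take-take; length-take;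
         drop-drop; take++drop≡id; ∷-dec; ∷-injectiveˡ; ∷-injectiveʳ)
open import Data.List.Relation.Unary.All as All using (All; []; _∷_)
import Data.List.Relation.Unary.All.Properties as All
open import Data.Maybe using (Maybe; just; nothing)
import Data.Maybe.Properties as Maybe
open import Data.Product using (_×_; _,_; proj₁; proj₂; ∃-syntax)
open import Data.Sum using (_⊎_; inj₁; inj₂; [_,_]′)
open import Data.Unit using (⊤; tt)
open import Data.Empty using (⊥-elim)
open import Function using (_∘_)
open import Function.Bundles using (_⇔_; mk⇔; Equivalence)
open import Induction.WellFounded using (Acc; acc)
open import Relation.Binary.Construct.Closure.ReflexiveTransitive using (Star; ε; _◅_; _◅◅_)
open import Relation.Binary.Definitions using (tri<; tri≈; tri>)
open import Relation.Binary.PropositionalEquality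
  using (_≡_; _≢_; refl; sym; trans; cong; subst; subst₂; module ≡-Reasoning)
open import Relation.Nullary using (¬_; Dec; yes; no; contradiction)
import Relation.Nullary.Decidable as Dec

open ≡-Reasoning

private variable
  B : Set
  xs ys : List B

_≼_ : List B → List B → Set
xs ≼ ys = ∃[ t ] ys ≡ xs ++ t

take-++ˡ : ∀ ℓ (xs ys : List B) → ℓ ≤ length xs → take ℓ (xs ++ ys) ≡ take ℓ xs
take-++ˡ zero    xs       ys _         = refl
take-++ˡ (suc ℓ) (x ∷ xs) ys (s≤s ℓ≤) = cong (x ∷_) (take-++ˡ ℓ xs ys ℓ≤)

take-length-++ : ∀ (xs ys : List B) → take (length xs) (xs ++ ys) ≡ xs
take-length-++ xs ys = trans (take-++ˡ _ xs ys ≤-refl) (take-all _ xs ≤-refl)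

drop-length-++ : ∀ (xs ys : List B) → drop (length xs) (xs ++ ys) ≡ ys
drop-length-++ []       ys = refl
drop-length-++ (x ∷ xs) ys = drop-length-++ xs ys

drop-++ˡ : ∀ ℓ (xs ys : List B) → ℓ ≤ length xs → drop ℓ (xs ++ ys) ≡ drop ℓ xs ++ ys
drop-++ˡ zero    xs       ys _         = refl
drop-++ˡ (suc ℓ) (x ∷ xs) ys (s≤s ℓ≤) = drop-++ˡ ℓ xs ys ℓ≤

≼⇒take-≡ : ∀ {ℓ} → xs ≼ ys → ℓ ≤ length xs → take ℓ xs ≡ take ℓ ys
≼⇒take-≡ {xs = xs} {ℓ = ℓ} (t , refl) ℓ≤ = sym (take-++ˡ ℓ xs t ℓ≤)

take-take-≤ : ∀ {e ℓ} (xs : List B) → e ≤ ℓ → take e (take ℓ xs) ≡ take e xs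
take-take-≤ {e = e} {ℓ} xs e≤ℓ =
  trans (take-take e ℓ xs) (cong (λ d → take d xs) (m≤n⇒m⊓n≡m e≤ℓ))

take-≡-mono : ∀ {e ℓ} → e ≤ ℓ → take ℓ xs ≡ take ℓ ys → take e xs ≡ take e ys
take-≡-mono {xs = xs} {ys} {e} {ℓ} e≤ℓ eq = begin
  take e xs            ≡⟨ take-take-≤ xs e≤ℓ ⟨
  take e (take ℓ xs)   ≡⟨ cong (take e) eq ⟩
  take e (take ℓ ys)   ≡⟨ take-take-≤ ys e≤ℓ ⟩
  take e ys            ∎

take-≡-length : ∀ {ℓ} → ℓ ≤ length xs → take ℓ xs ≡ take ℓ ys → ℓ ≤ length ys
take-≡-length {ℓ = zero}                       _        _  = z≤n
take-≡-length {xs = _ ∷ _} {[]}    {suc ℓ} _        ()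
take-≡-length {xs = _ ∷ _} {_ ∷ _} {suc ℓ} (s≤s ℓ≤) eq =
  s≤s (take-≡-length ℓ≤ (∷-injectiveʳ eq))

take-≡-head : ∀ {ℓ} → take (suc ℓ) xs ≡ take (suc ℓ) ys → head xs ≡ head ys
take-≡-head {xs = []}    {[]}    _  = refl
take-≡-head {xs = _ ∷ _} {_ ∷ _} eq = cong just (∷-injectiveˡ eq)

take-≡-head-after : ∀ {ℓ} (xs ys zs : List B) → length xs < ℓ →
                    take ℓ (xs ++ ys) ≡ take ℓ (xs ++ zs) → head ys ≡ head zs
take-≡-head-after {ℓ = suc ℓ} []       ys zs _        eq = take-≡-head eq
take-≡-head-after {ℓ = suc ℓ} (x ∷ xs) ys zs (s≤s lt) eq =
  take-≡-head-after xs ys zs lt (∷-injectiveʳ eq)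

head-++ : xs ≢ [] → head (xs ++ ys) ≡ head xs
head-++ {xs = []}    xs≢[] = ⊥-elim (xs≢[] refl)
head-++ {xs = _ ∷ _} _     = refl

length-++-< : ∀ (xs : List B) → ys ≢ [] → length xs < length (xs ++ ys)
length-++-< {ys = []}    xs ys≢[] = ⊥-elim (ys≢[] refl)
length-++-< {ys = _ ∷ _} xs _     =
  subst (length xs <_) (sym (length-++ xs)) (m<m+n (length xs) (s≤s z≤n))

All-≡-dec : {P : B → Set} → (∀ {x y} → P x → P y → Dec (x ≡ y)) →
            All P xs → All P ys → Dec (xs ≡ ys)
All-≡-dec _≟_ []       []       = yes refl
All-≡-dec _≟_ []       (_ ∷ _)  = no λ ()
All-≡-dec _≟_ (_ ∷ _)  []       = no λ ()
All-≡-dec _≟_ (p ∷ ps) (q ∷ qs) = ∷-dec (p ≟ q) (All-≡-dec _≟_ ps qs)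

length-^^ : ∀ (x : List B) k → length (x ^^ k) ≡ k * length x
length-^^ x zero    = refl
length-^^ x (suc k) = trans (length-++ x) (cong (length x +_) (length-^^ x k))

^^-suc : ∀ (x : List B) k → x ^^ suc k ≡ x ^^ k ++ x
^^-suc x zero    = ++-identityʳ x
^^-suc x (suc k) = trans (cong (x ++_) (^^-suc x k)) (sym (++-assoc x (x ^^ k) x))

take-power⇔prefixPower : ∀ k m (u : List B) → m ≤ length u →
                         (take (suc k * m) u ≡ take m u ^^ suc k) ⇔ PrefixPower (suc k) m u
take-power⇔prefixPower k m u m≤u = mk⇔ (λ pow → take m u , length-take-m , pow) period
  where
  length-take-m : length (take m u) ≡ m
  length-take-m = trans (length-take m u) (m≤n⇒m⊓n≡m m≤u)
  period : PrefixPower (suc k) m u → take (suc k * m) u ≡ take m u ^^ suc k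
  period (x , refl , pow) = subst (λ y → take (suc k * length x) u ≡ y ^^ suc k) (sym take≡x) pow
    where
    take≡x : take (length x) u ≡ x
    take≡x = begin
      take (length x) u                           ≡⟨ take-take-≤ u (m≤m+n _ (k * length x)) ⟨
      take (length x) (take (suc k * length x) u) ≡⟨ cong (take (length x)) pow ⟩
      take (length x) (x ++ x ^^ k)               ≡⟨ take-length-++ x (x ^^ k) ⟩
      x                                           ∎

mpCand-++⁻ : ∀ {k s m} (u t : List B) → k * m ≤ length u → MpCand k s (u ++ t) m → MpCand k s u m
mpCand-++⁻ u t km≤u (s<m , _ , x , |x|≡m , pow) =
  s<m , km≤u , x , |x|≡m , trans (sym (take-++ˡ _ u t km≤u)) pow

least-or-none : {P : ℕ → Set} → (∀ m → Dec (P m)) → ∀ b →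
                (∃[ m ] (P m × ∀ {m′} → m′ < m → ¬ P m′)) ⊎ (∀ {m} → m < b → ¬ P m)
least-or-none P? zero = inj₂ λ ()
least-or-none P? (suc b) with least-or-none P? b
... | inj₁ least = inj₁ least
... | inj₂ none with P? b
...   | yes Pb  = inj₁ (b , Pb , none)
...   | no  ¬Pb = inj₂ λ m<1+b → [ none , (λ { refl → ¬Pb }) ]′ (m<1+n⇒m<n∨m≡n m<1+b)

shift-closed-bounded-empty : (P : ℕ → Set) {n d : ℕ} → 0 < d →
                             (∀ i → P i → i < n) → (∀ i → P i → P (i + d)) → ∀ i → ¬ P i
shift-closed-bounded-empty P {n} {d} 0<d bounded shift i₀ = go n i₀ (m≤m+n n i₀)
  where
  go : ∀ f i → n ≤ f + i → ¬ P i
  go zero    i n≤i Pi = <⇒≱ (bounded i Pi) n≤i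
  go (suc f) i n≤  Pi = go f (i + d) (≤-trans n≤ f+i<f+[i+d]) (shift i Pi)
    where
    f+i<f+[i+d] : suc (f + i) ≤ f + (i + d)
    f+i<f+[i+d] = subst (_≤ f + (i + d)) (+-suc f i) (+-monoʳ-≤ f (m<m+n i 0<d))

Fin-bounded : ∀ {n} (f : Fin n → ℕ) → ∃[ b ] (∀ i → f i ≤ b)
Fin-bounded {zero}  f = 0 , λ ()
Fin-bounded {suc n} f with Fin-bounded (f ∘ suc)
... | b , f≤b = f zero ⊔ b , λ { zero    → m≤m⊔n (f zero) b
                               ; (suc i) → ≤-trans (f≤b i) (m≤n⊔m (f zero) b) }

endmarked : List B → List (Maybe B)
endmarked xs = map just xs ++ [ nothing ]

head-endmarked⇒< : ∀ i (xs : List B) {a} → head (drop i (endmarked xs)) ≡ just (just a) →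
                   i < length xs
head-endmarked⇒< zero          []       ()
head-endmarked⇒< (suc zero)    []       ()
head-endmarked⇒< (suc (suc i)) []       ()
head-endmarked⇒< zero          (x ∷ xs) _ = s≤s z≤n
head-endmarked⇒< (suc i)       (x ∷ xs) h = s≤s (head-endmarked⇒< i xs h)

<⇒head-endmarked : ∀ i (xs : List B) → i < length xs →
                   ∃[ a ] head (drop i (endmarked xs)) ≡ just (just a)
<⇒head-endmarked zero    (x ∷ xs) _        = x , refl
<⇒head-endmarked (suc i) (x ∷ xs) (s≤s lt) = <⇒head-endmarked i xs lt

endmarked-letters-head : ∀ (xs : List B) →
                         All (λ a → ∃[ i ] head (drop i (endmarked xs)) ≡ just (just a)) xs
endmarked-letters-head []       = []
endmarked-letters-head (x ∷ xs) =
  (0 , refl) ∷ All.map (λ (i , h) → suc i , h) (endmarked-letters-head xs)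

module _ {A : Set} {w : List A} (T : SuffixTree w) where
  open SuffixTree T

  private variable
    a b c p u v : Fin N

  _↝*_ : Fin N → Fin N → Set
  _↝*_ = Star (λ p c → father c ≡ just p)

  root-or-child : ∀ a → a ≡ root ⊎ ∃[ p ] father a ≡ just p
  root-or-child a with father a in fa
  ... | nothing = inj₁ (Equivalence.to (father-root a) fa)
  ... | just p  = inj₂ (p , refl)

  δ-root : δ root ≡ 0
  δ-root = cong length τ-root

  δ-child : father c ≡ just p → δ p < δ c
  δ-child {c = c} {p = p} fc =
    subst (λ t → δ p < length t) (sym (τ-edge c p fc)) (length-++-< (τ p) (label-ne c p fc))

  δ≡0⇒root : δ a ≡ 0 → a ≡ root
  δ≡0⇒root {a = a} δa≡0 with root-or-child a
  ... | inj₁ a≡root   = a≡root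
  ... | inj₂ (p , fa) = ⊥-elim (n≮0 (subst (δ p <_) δa≡0 (δ-child fa)))

  τ-child≢[] : father c ≡ just p → τ c ≢ []
  τ-child≢[] {p = p} fc τc≡[] = n≮0 (subst (δ p <_) (cong length τc≡[]) (δ-child fc))

  τ-parent : father c ≡ just p → take (δ p) (τ c) ≡ τ p
  τ-parent {c = c} {p = p} fc =
    trans (cong (take (δ p)) (τ-edge c p fc)) (take-length-++ (τ p) (label c))

  ↝*⇒τ-≼ : a ↝* b → τ a ≼ τ b
  ↝*⇒τ-≼ ε = [] , sym (++-identityʳ _)
  ↝*⇒τ-≼ {a = a} (_◅_ {j = c} fc c↝b) with ↝*⇒τ-≼ c↝b
  ... | t , τb≡ = label c ++ t , (begin
    _                      ≡⟨ τb≡ ⟩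
    τ c ++ t               ≡⟨ cong (_++ t) (τ-edge c a fc) ⟩
    (τ a ++ label c) ++ t  ≡⟨ ++-assoc (τ a) (label c) t ⟩
    τ a ++ label c ++ t    ∎)

  OnEdge : ℕ → Fin N → Set
  OnEdge ℓ a = ∃[ p ] (father a ≡ just p × δ p < ℓ × ℓ ≤ δ a)

  onEdge-self : father a ≡ just p → OnEdge (δ a) a
  onEdge-self {p = p} fa = p , fa , δ-child fa , ≤-refl

  EdgeUnique : ℕ → Set
  EdgeUnique ℓ = ∀ {a b} → OnEdge ℓ a → OnEdge ℓ b → take ℓ (τ a) ≡ take ℓ (τ b) → a ≡ b

  EdgeUniqueBelow : ℕ → Set
  EdgeUniqueBelow ℓ = ∀ {ℓ′} → ℓ′ < ℓ → EdgeUnique ℓ′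

  parent-not-inside : ∀ {ℓ} → EdgeUniqueBelow ℓ →
                      father a ≡ just p → ℓ ≤ δ a → father b ≡ just u → δ u < ℓ →
                      take ℓ (τ a) ≡ take ℓ (τ b) → ¬ δ p < δ u
  parent-not-inside {a = a} {p = p} {u = u} {ℓ = ℓ} ih fa ℓ≤a fb u<ℓ agree p<u
    with root-or-child u
  ... | inj₁ refl     = n≮0 (subst (δ p <_) δ-root p<u)
  ... | inj₂ (_ , fu) = <⇒≱ u<ℓ (subst (λ x → ℓ ≤ δ x) a≡u ℓ≤a)
    where
    a≡u : a ≡ u
    a≡u = ih u<ℓ (p , fa , p<u , ≤-trans (<⇒≤ u<ℓ) ℓ≤a) (onEdge-self fu) (begin
      take (δ u) (τ a)  ≡⟨ take-≡-mono (<⇒≤ u<ℓ) agree ⟩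
      take (δ u) (τ _)  ≡⟨ τ-parent fb ⟩
      τ u               ≡⟨ take-all (δ u) (τ u) ≤-refl ⟨
      take (δ u) (τ u)  ∎)

  τ-injective-below : ∀ {ℓ} → EdgeUniqueBelow ℓ → δ a < ℓ → τ a ≡ τ b → a ≡ b
  τ-injective-below {a = a} {b = b} ih a<ℓ τa≡τb with root-or-child a | root-or-child b
  ... | inj₁ refl     | _             = sym (δ≡0⇒root (trans (cong length (sym τa≡τb)) δ-root))
  ... | inj₂ _        | inj₁ refl     = δ≡0⇒root (trans (cong length τa≡τb) δ-root)
  ... | inj₂ (_ , fa) | inj₂ (_ , fb) =
    ih a<ℓ (onEdge-self fa) (subst (λ d → OnEdge d b) (cong length (sym τa≡τb)) (onEdge-self fb))
       (cong (take (δ a)) τa≡τb)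

  onEdge-unique : ∀ ℓ → EdgeUnique ℓ
  onEdge-unique = <-rec EdgeUnique step
    where
    step : ∀ ℓ → EdgeUniqueBelow ℓ → EdgeUnique ℓ
    step ℓ ih {a} {b} (pa , fa , pa<ℓ , ℓ≤a) (pb , fb , pb<ℓ , ℓ≤b) agree
      with <-cmp (δ pa) (δ pb)
    ... | tri< pa<pb _ _ = ⊥-elim (parent-not-inside ih fa ℓ≤a fb pb<ℓ agree pa<pb)
    ... | tri> _ _ pb<pa = ⊥-elim (parent-not-inside ih fb ℓ≤b fa pa<ℓ (sym agree) pb<pa)
    ... | tri≈ _ δpa≡δpb _ =
      first-letters pa a b fa fb′ (take-≡-head-after (τ pa) (label a) (label b) pa<ℓ agree′)
      where
      τpa≡τpb : τ pa ≡ τ pb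
      τpa≡τpb = begin
        τ pa               ≡⟨ τ-parent fa ⟨
        take (δ pa) (τ a)  ≡⟨ take-≡-mono (<⇒≤ pa<ℓ) agree ⟩
        take (δ pa) (τ b)  ≡⟨ cong (λ d → take d (τ b)) δpa≡δpb ⟩
        take (δ pb) (τ b)  ≡⟨ τ-parent fb ⟩
        τ pb               ∎
      fb′ : father b ≡ just pa
      fb′ = subst (λ q → father b ≡ just q) (sym (τ-injective-below ih pa<ℓ τpa≡τpb)) fb
      agree′ : take ℓ (τ pa ++ label a) ≡ take ℓ (τ pa ++ label b)
      agree′ = subst₂ (λ x y → take ℓ x ≡ take ℓ y) (τ-edge a pa fa)
                      (trans (τ-edge b pb fb) (cong (_++ label b) (sym τpa≡τpb))) agree

  onEdge-ancestor : ∀ {ℓ} z → 0 < ℓ → ℓ ≤ δ z → ∃[ y ] (y ↝* z × OnEdge ℓ y)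
  onEdge-ancestor {ℓ} z = go z (<-wellFounded (δ z))
    where
    go : ∀ z → Acc _<_ (δ z) → 0 < ℓ → ℓ ≤ δ z → ∃[ y ] (y ↝* z × OnEdge ℓ y)
    go z (acc rec) 0<ℓ ℓ≤z with root-or-child z
    ... | inj₁ refl = ⊥-elim (<⇒≱ 0<ℓ (subst (ℓ ≤_) δ-root ℓ≤z))
    ... | inj₂ (p , fz) with δ p <? ℓ
    ...   | yes p<ℓ = z , ε , p , fz , p<ℓ , ℓ≤z
    ...   | no  p≮ℓ with go p (rec (δ-child fz)) 0<ℓ (≮⇒≥ p≮ℓ)
    ...     | y , y↝p , on-y = y , y↝p ◅◅ (fz ◅ ε) , on-y

  onEdge⇒↝* : ∀ {ℓ} z → OnEdge ℓ v → take ℓ (τ v) ≡ take ℓ (τ z) → v ↝* z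
  onEdge⇒↝* {v = v} {ℓ = ℓ} z on-v@(_ , _ , p<ℓ , ℓ≤v) agree
    with onEdge-ancestor z (≤-trans (s≤s z≤n) p<ℓ) (take-≡-length ℓ≤v agree)
  ... | y , y↝z , on-y@(_ , _ , _ , ℓ≤y) = subst (_↝* z) y≡v y↝z
    where
    y≡v : y ≡ v
    y≡v = onEdge-unique ℓ on-y on-v (trans (≼⇒take-≡ (↝*⇒τ-≼ y↝z) ℓ≤y) (sym agree))

  leaf-descendant : ∀ v → ∃[ j ] v ↝* leaf j
  leaf-descendant v = descend (suc maxδ) v (s≤s (m≤m+n maxδ (δ v)))
    where
    maxδ : ℕ
    maxδ = proj₁ (Fin-bounded δ)
    descend : ∀ f v → maxδ < f + δ v → ∃[ j ] v ↝* leaf j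
    descend zero v max<δv = ⊥-elim (<⇒≱ max<δv (proj₂ (Fin-bounded δ) v))
    descend (suc f) v max< with Fin.any? (λ c → Maybe.≡-dec Fin._≟_ (father c) (just v))
    ... | yes (c , fc) with descend f c (≤-trans max< (subst (_≤ f + δ c) (+-suc f (δ v))
                                                             (+-monoʳ-≤ f (δ-child fc))))
    ...   | j , c↝leaf = j , fc ◅ c↝leaf
    descend (suc f) v max< | no childless with leaf-all v (λ c fc → childless (c , fc))
    ...   | j , leaf≡v = j , subst (v ↝*_) (sym leaf≡v) ε

  -- sfx i = w[i+1..n]$ for i < n; beyond that it is [$] or [].
  sfx : ℕ → List (Maybe A)
  sfx i = drop i (endmarked w)

  τ-leaf-sfx : ∀ j → τ (leaf j) ≡ sfx (toℕ j)
  τ-leaf-sfx j = trans (τ-leaf j) (sym (drop-++ˡ (toℕ j) (map just w) _ j≤))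
    where
    j≤ : toℕ j ≤ length (map just w)
    j≤ = subst (toℕ j ≤_) (sym (length-map just w)) (<⇒≤ (Fin.toℕ<n j))

  τ-leaf-fromℕ< : ∀ {i} (i<n : i < length w) → τ (leaf (fromℕ< i<n)) ≡ sfx i
  τ-leaf-fromℕ< i<n = trans (τ-leaf-sfx _) (cong sfx (Fin.toℕ-fromℕ< i<n))

  τ-prefix-sfx : ∀ v → ∃[ i ] (i < length w × τ v ≼ sfx i)
  τ-prefix-sfx v with leaf-descendant v
  ... | j , v↝leaf = toℕ j , Fin.toℕ<n j , subst (τ v ≼_) (τ-leaf-sfx j) (↝*⇒τ-≼ v↝leaf)

  τ-head : father v ≡ just u → ∃[ a ] head (τ v) ≡ just (just a)
  τ-head {v = v} fv with τ-prefix-sfx v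
  ... | i , i<n , t , sfx≡ with <⇒head-endmarked i w i<n
  ...   | a , h = a , (begin
    head (τ v)       ≡⟨ head-++ (τ-child≢[] fv) ⟨
    head (τ v ++ t)  ≡⟨ cong head sfx≡ ⟨
    head (sfx i)     ≡⟨ h ⟩
    just (just a)    ∎)

  head-sfx⇒< : ∀ {i} → father v ≡ just u → head (τ v) ≡ head (sfx i) → i < length w
  head-sfx⇒< {i = i} fv h = head-endmarked⇒< i w (trans (sym h) (proj₂ (τ-head fv)))

  agree-past-parent⇒≼ : ∀ i → father v ≡ just u →
                        take (suc (δ u)) (τ v) ≡ take (suc (δ u)) (sfx i) → τ v ≼ sfx i
  agree-past-parent⇒≼ {v = v} {u = u} i fv agree = subst (τ v ≼_) τ-leaf≡sfx (↝*⇒τ-≼ v↝leaf)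
    where
    i<n : i < length w
    i<n = head-sfx⇒< fv (take-≡-head agree)
    τ-leaf≡sfx : τ (leaf (fromℕ< i<n)) ≡ sfx i
    τ-leaf≡sfx = τ-leaf-fromℕ< i<n
    v↝leaf : v ↝* leaf (fromℕ< i<n)
    v↝leaf = onEdge⇒↝* _ (u , fv , n<1+n _ , δ-child fv)
                         (trans agree (cong (take _) (sym τ-leaf≡sfx)))

  RootEdgeStarting : Maybe A → Set
  RootEdgeStarting c = ∃[ r ] (father r ≡ just root × head (label r) ≡ just c)

  root-edge : ∀ y {c} → head (τ y) ≡ just c → RootEdgeStarting c
  root-edge y = go y (<-wellFounded (δ y))
    where
    go : ∀ y {c} → Acc _<_ (δ y) → head (τ y) ≡ just c → RootEdgeStarting c
    go y (acc rec) h with root-or-child y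
    ... | inj₁ refl = contradiction (trans (sym (cong head τ-root)) h) λ ()
    ... | inj₂ (p , fy) with root-or-child p
    ...   | inj₁ refl =
      y , fy , trans (cong head (sym (trans (τ-edge y root fy) (cong (_++ label y) τ-root)))) h
    ...   | inj₂ (_ , fp) =
      go p (rec (δ-child fy)) (trans (sym (head-++ (τ-child≢[] fp)))
                                     (trans (cong head (sym (τ-edge y p fy))) h))

  -- A has no decidable equality, but the letters of w do: each starts its own edge out of the root.
  Letter : Maybe A → Set
  Letter nothing  = ⊤
  Letter (just a) = RootEdgeStarting (just a)

  letter-≟ : ∀ {c d} → Letter c → Letter d → Dec (c ≡ d)
  letter-≟ {nothing} {nothing} _ _ = yes refl
  letter-≟ {nothing} {just _}  _ _ = no λ ()
  letter-≟ {just _}  {nothing} _ _ = no λ ()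
  letter-≟ {just a}  {just b}  (r , fr , hr) (r′ , fr′ , hr′) with r Fin.≟ r′
  ... | yes refl = yes (Maybe.just-injective (trans (sym hr) hr′))
  ... | no  r≢r′ = no λ a≡b →
    r≢r′ (first-letters root r r′ fr fr′ (trans hr (trans (cong just a≡b) (sym hr′))))

  letters-endmarked : All Letter (endmarked w)
  letters-endmarked = All.++⁺ (All.map⁺ (All.map letter (endmarked-letters-head w))) (tt ∷ [])
    where
    letter : ∀ {a} → ∃[ i ] head (sfx i) ≡ just (just a) → Letter (just a)
    letter (i , h) = root-edge (leaf (fromℕ< i<n)) (trans (cong head (τ-leaf-fromℕ< i<n)) h)
      where
      i<n : i < length w
      i<n = head-endmarked⇒< i w h

  τ-letters : ∀ v → All Letter (τ v)
  τ-letters v with τ-prefix-sfx v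
  ... | i , _ , t , sfx≡ = All.++⁻ˡ (τ v) (subst (All Letter) sfx≡ (All.drop⁺ i letters-endmarked))

  mpCand-dec : ∀ v k s m → Dec (MpCand (suc k) s (τ v) m)
  mpCand-dec v k s m with s <? m | suc k * m ≤? δ v
  ... | no s≮m  | _       = no (s≮m ∘ proj₁)
  ... | yes _   | no km≰  = no (km≰ ∘ proj₁ ∘ proj₂)
  ... | yes s<m | yes km≤ =
    Dec.map′ (λ pp → s<m , km≤ , pp) (proj₂ ∘ proj₂)
      (Dec.map (take-power⇔prefixPower k m (τ v) (≤-trans (m≤m+n m (k * m)) km≤))
        (All-≡-dec letter-≟ (All.take⁺ _ (τ-letters v))
                            (All.concat⁺ (All.replicate⁺ (suc k) (All.take⁺ m (τ-letters v))))))

  mpCand-lower : ∀ {k s m} → father v ≡ just u → MpInfinite k s (τ u) → MpCand k s (τ v) m →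
                 δ u < k * m
  mpCand-lower {v = v} {u = u} {k = k} {s = s} {m = m} fv inf cand = ≰⇒> λ km≤δu →
    inf m (mpCand-++⁻ {k = k} (τ u) (label v) km≤δu
                      (subst (λ t → MpCand k s t m) (τ-edge v u fv) cand))

  periodic-prefix-shift : ∀ {k} {x D : List (Maybe A)} → father v ≡ just u →
                          τ v ≡ x ^^ suc k ++ D → δ u < k * length x →
                          ∀ i → τ v ≼ sfx i → τ v ≼ sfx (i + length x)
  periodic-prefix-shift {v = v} {u = u} {k} {x} {D} fv τv≡ δu< i (t , sfx≡) =
    agree-past-parent⇒≼ (i + length x) fv (begin
      take ℓ (τ v)                  ≡⟨ cong (take ℓ) τv≡xᵏ++x++D ⟩
      take ℓ (x ^^ k ++ x ++ D)     ≡⟨ take-++ˡ ℓ _ _ ℓ≤ ⟩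
      take ℓ (x ^^ k)               ≡⟨ take-++ˡ ℓ _ _ ℓ≤ ⟨
      take ℓ (x ^^ k ++ D ++ t)     ≡⟨ cong (take ℓ) sfx-shift ⟨
      take ℓ (sfx (i + length x))   ∎)
    where
    ℓ : ℕ
    ℓ = suc (δ u)
    ℓ≤ : ℓ ≤ length (x ^^ k)
    ℓ≤ = subst (ℓ ≤_) (sym (length-^^ x k)) δu<
    τv≡xᵏ++x++D : τ v ≡ x ^^ k ++ x ++ D
    τv≡xᵏ++x++D = trans τv≡ (trans (cong (_++ D) (^^-suc x k)) (++-assoc (x ^^ k) x D))
    sfx-shift : sfx (i + length x) ≡ x ^^ k ++ D ++ t
    sfx-shift = begin
      sfx (i + length x)                         ≡⟨ drop-drop i (length x) _ ⟨
      drop (length x) (sfx i)                    ≡⟨ cong (drop (length x)) sfx≡ ⟩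
      drop (length x) (τ v ++ t)                 ≡⟨ cong (λ y → drop (length x) (y ++ t)) τv≡x++xᵏ++D ⟩
      drop (length x) ((x ++ x ^^ k ++ D) ++ t)  ≡⟨ cong (drop (length x)) (++-assoc x _ t) ⟩
      drop (length x) (x ++ (x ^^ k ++ D) ++ t)  ≡⟨ drop-length-++ x _ ⟩
      (x ^^ k ++ D) ++ t                         ≡⟨ ++-assoc (x ^^ k) D t ⟩
      x ^^ k ++ D ++ t                           ∎
      where
      τv≡x++xᵏ++D : τ v ≡ x ++ x ^^ k ++ D
      τv≡x++xᵏ++D = trans τv≡ (++-assoc x (x ^^ k) D)

  mpCand-upper : ∀ {k s m} → father v ≡ just u → MpCand (suc k) s (τ v) m → k * m ≤ δ u
  mpCand-upper {v = v} {u = u} {k = k} fv (s<m , _ , x , refl , pow) with k * length x ≤? δ u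
  ... | yes km≤δu = km≤δu
  ... | no  km≰δu with τ-prefix-sfx v
  ...   | i , _ , τv≼sfx-i =
    ⊥-elim (shift-closed-bounded-empty (λ i → τ v ≼ sfx i) 0<|x| bounded shift i τv≼sfx-i)
    where
    0<|x| : 0 < length x
    0<|x| = ≤-trans (s≤s z≤n) s<m
    bounded : ∀ i → τ v ≼ sfx i → i < length w
    bounded i (t , sfx≡) =
      head-sfx⇒< fv (trans (sym (head-++ (τ-child≢[] fv))) (cong head (sym sfx≡)))
    rest : List (Maybe A)
    rest = drop (suc k * length x) (τ v)
    τv≡ : τ v ≡ x ^^ suc k ++ rest
    τv≡ = trans (sym (take++drop≡id (suc k * length x) (τ v))) (cong (_++ rest) pow)
    shift : ∀ i → τ v ≼ sfx i → τ v ≼ sfx (i + length x)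
    shift = periodic-prefix-shift {k = k} {x = x} fv τv≡ (≰⇒> km≰δu)

lemma5 : {A : Set} (k s : ℕ) (w : List A) (T : SuffixTree w) →
         2 ≤ k →
         (v u : Fin (SuffixTree.N T)) → SuffixTree.father T v ≡ just u →
         MpInfinite k s (SuffixTree.τ T u) →
         MpInfinite k s (SuffixTree.τ T v)
         ⊎ (∃[ m ] (IsMp k s (SuffixTree.τ T v) m
                    × SuffixTree.δ T u < k * m
                    × (k ∸ 1) * m ≤ SuffixTree.δ T u))
lemma5 zero    s w T () v u fv inf
lemma5 (suc k) s w T _  v u fv inf with least-or-none (mpCand-dec T v k s) (suc (SuffixTree.δ T v))
... | inj₂ none =
  inj₁ λ m cand → none (s≤s (≤-trans (m≤m+n m (k * m)) (proj₁ (proj₂ cand)))) cand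
... | inj₁ (m , cand , minimal) =
  inj₂ (m , (cand , least) , mpCand-lower T {k = suc k} fv inf cand , mpCand-upper T {k = k} fv cand)
  where
  least : ∀ m′ → MpCand (suc k) s (SuffixTree.τ T v) m′ → m ≤ m′
  least m′ cand′ = ≮⇒≥ λ m′<m → minimal m′<m cand′
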